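{- Let $a$ be an integer with $|a|\le 2$ and let $x=(x_1,x_2,x_3)\in\Gamma_a\setminus\Theta_a$. Then the sequence $(x_1^2,x_2^2,x_3^2)$ is either strictly increasing or strictly decreasing.
   Context: For an integer $a$, $\Gamma_a$ is the set of $(x_1,x_2,x_3)\in\mathbb{Z}^3$ with $x_1^2-2x_2^2+x_3^2=a$. Let $\mathcal{C}=\{x\in\mathbb{Z}^3: |x_1|\le|x_2| \text{ or } |x_1|\ge 2|x_2|\}$. Define $\Theta_a=\{x\in\Gamma_a: |x_2|\ge\max\{|x_1|,|x_3|\}\}$ if $a<0$, and $\Theta_a=\{x\in\Gamma_a: x\in\mathcal{C}\text{ and }(x_3,x_2,x_1)\in\mathcal{C}\}$ if $a\ge 0$. -}

module Defs where

open import Data.Integer using (ℤ; +_; _+_; _-_; _*_; ∣_∣; _<_; _≤_; -_)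
open import Data.Nat as ℕ using (ℕ)
open import Data.Product using (_×_; _,_)
open import Data.Sum using (_⊎_)
open import Relation.Binary.PropositionalEquality using (_≡_)

ℤ³ : Set
ℤ³ = ℤ × ℤ × ℤ

Γ : ℤ → ℤ³ → Set
Γ a (x₁ , x₂ , x₃) = x₁ * x₁ - (+ 2) * (x₂ * x₂) + x₃ * x₃ ≡ a

𝒞 : ℤ³ → Set
𝒞 (x₁ , x₂ , x₃) = (∣ x₁ ∣ ℕ.≤ ∣ x₂ ∣) ⊎ (2 ℕ.* ∣ x₂ ∣ ℕ.≤ ∣ x₁ ∣)

ΘCond : ℤ → ℤ³ → Set
ΘCond a (x₁ , x₂ , x₃) with a
... | + n = 𝒞 (x₁ , x₂ , x₃) × 𝒞 (x₃ , x₂ , x₁)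
... | _   = (∣ x₁ ∣ ℕ.≤ ∣ x₂ ∣) × (∣ x₃ ∣ ℕ.≤ ∣ x₂ ∣)

Θ : ℤ → ℤ³ → Set
Θ a x = Γ a x × ΘCond a x

SqIncr : ℤ³ → Set
SqIncr (x₁ , x₂ , x₃) = (x₁ * x₁ < x₂ * x₂) × (x₂ * x₂ < x₃ * x₃)

SqDecr : ℤ³ → Set
SqDecr (x₁ , x₂ , x₃) = (x₂ * x₂ < x₁ * x₁) × (x₃ * x₃ < x₂ * x₂)

module Submission where

-- Write u = |x₁|, v = |x₂|, w = |x₃|.  The equation of Γ_a
-- becomes u² + w² + m = 2v² + n in ℕ, with (m, n) = (0, a) for a ≥ 0 and
-- (|a|, 0) for a < 0.  The whole argument rests on one estimate
-- (`outer-dominates`): if v < u and n ≤ 2v + m, then w² < v² < u², because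
-- u² ≥ (v+1)² = v² + 2v + 1 leaves less than v² for w².
--   * a = n ≥ 0: x ∉ Θ_a means one of (u,v), (w,v) lies outside the cone 𝒞,
--     i.e. v < u < 2v (resp. v < w < 2v); then v ≥ 1 and n ≤ 2 ≤ 2v.
--   * a < 0: x ∉ Θ_a means v < u or v < w, and the estimate applies with the
--     deficit |a| on the left-hand side.
-- The equation is symmetric in u and w, so the case "u is the big one" gives
-- a decreasing sequence of squares and "w is the big one" an increasing one.

open import Defs
open import Data.Integer using (ℤ; ∣_∣)
open import Data.Nat using (_≤_)
open import Data.Sum using (_⊎_)
open import Relation.Nullary using (¬_)

open import Data.Integer as ℤ using (+_; -[1+_]; _-_)
import Data.Integer.Properties as ℤ
open import Data.Integer.Tactic.RingSolver using (solve-∀)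
open import Data.Nat as ℕ using (ℕ; suc; _+_; _*_; _<_; z≤n; s≤s)
open import Data.Nat.Properties
import Data.Nat.Tactic.RingSolver as ℕ-Solver
open import Data.Product using (_×_; _,_)
open import Data.Sum using (inj₁; inj₂)
open import Function using (_∘_)
open import Relation.Binary.PropositionalEquality
open import Relation.Nullary using (Dec; yes; no; contradiction)
open import Relation.Nullary.Decidable using (_⊎-dec_)

-- Consecutive squares differ by 2v + 1, so v < u forces a gap of that size.
square-gap : ∀ {u v} → v < u → v * v + 2 * v + 1 ≤ u * u
square-gap {u} {v} v<u = subst (_≤ u * u) (expand v) (*-mono-≤ v<u v<u)
  where
  expand : ∀ v → suc v * suc v ≡ v * v + 2 * v + 1
  expand = ℕ-Solver.solve-∀

smaller-square : ∀ u v w m n → u * u + w * w + m ≡ 2 * (v * v) + n →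
                 v * v + n < u * u + m → w * w < v * v
smaller-square u v w m n eq big = +-cancelʳ-< (v * v + n) (w * w) (v * v) (begin-strict
  w * w + (v * v + n)   <⟨ +-monoʳ-< (w * w) big ⟩
  w * w + (u * u + m)   ≡⟨ rearrange (w * w) (u * u) m ⟩
  u * u + w * w + m     ≡⟨ eq ⟩
  2 * (v * v) + n       ≡⟨ double (v * v) n ⟩
  v * v + (v * v + n)   ∎)
  where
  open ≤-Reasoning
  rearrange : ∀ W U m → W + (U + m) ≡ U + W + m
  rearrange = ℕ-Solver.solve-∀
  double : ∀ V n → 2 * V + n ≡ V + (V + n)
  double = ℕ-Solver.solve-∀

outer-dominates : ∀ u v w m n → u * u + w * w + m ≡ 2 * (v * v) + n →
                  v < u → n ≤ 2 * v + m → w * w < v * v × v * v < u * u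
outer-dominates u v w m n eq v<u n≤2v+m =
  smaller-square u v w m n eq big , *-mono-< v<u v<u
  where
  open ≤-Reasoning
  big : v * v + n < u * u + m
  big = begin-strict
    v * v + n                 ≤⟨ +-monoʳ-≤ (v * v) n≤2v+m ⟩
    v * v + (2 * v + m)       <⟨ +-monoʳ-< (v * v) (m<m+n (2 * v + m) (s≤s z≤n)) ⟩
    v * v + (2 * v + m + 1)   ≡⟨ regroup (v * v) (2 * v) m ⟩
    v * v + 2 * v + 1 + m     ≤⟨ +-monoˡ-≤ m (square-gap v<u) ⟩
    u * u + m                 ∎
    where
    regroup : ∀ V D m → V + (D + m + 1) ≡ V + D + 1 + m
    regroup = ℕ-Solver.solve-∀

InCone : ℕ → ℕ → Set
InCone u v = (u ≤ v) ⊎ (2 * v ≤ u)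

inCone? : ∀ u v → Dec (InCone u v)
inCone? u v = (u ℕ.≤? v) ⊎-dec (2 * v ℕ.≤? u)

outside-cone : ∀ {u v} → ¬ InCone u v → v < u × u < 2 * v
outside-cone ∉𝒞 = ≰⇒> (∉𝒞 ∘ inj₁) , ≰⇒> (∉𝒞 ∘ inj₂)

-- Between v and 2v there is room only when v ≥ 1, so then 2 ≤ 2v.
two≤double : ∀ {u v} → v < u → u < 2 * v → 2 ≤ 2 * v
two≤double {v = ℕ.zero} v<u u<2v = contradiction (<-trans v<u u<2v) (λ ())
two≤double {v = suc v} _ _ = *-monoʳ-≤ 2 (s≤s z≤n)

outside-cone-dominates : ∀ u v w n → n ≤ 2 → u * u + w * w + 0 ≡ 2 * (v * v) + n →
                         ¬ InCone u v → w * w < v * v × v * v < u * u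
outside-cone-dominates u v w n n≤2 eq u∉𝒞 with outside-cone u∉𝒞
... | v<u , u<2v = outer-dominates u v w 0 n eq v<u n≤2v+0
  where
  n≤2v+0 : n ≤ 2 * v + 0
  n≤2v+0 = ≤-trans (≤-trans n≤2 (two≤double v<u u<2v)) (m≤m+n (2 * v) 0)

square-abs : ∀ x → x ℤ.* x ≡ + (∣ x ∣ * ∣ x ∣)
square-abs (+ n) = sym (ℤ.pos-* n n)
square-abs -[1+ n ] = refl

square-< : ∀ x y → ∣ x ∣ * ∣ x ∣ < ∣ y ∣ * ∣ y ∣ → x ℤ.* x ℤ.< y ℤ.* y
square-< x y lt rewrite square-abs x | square-abs y = ℤ.+<+ lt

Γ-abs : ∀ a x₁ x₂ x₃ → Γ a (x₁ , x₂ , x₃) →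
        + (∣ x₁ ∣ * ∣ x₁ ∣ + ∣ x₃ ∣ * ∣ x₃ ∣) ≡ + (2 * (∣ x₂ ∣ * ∣ x₂ ∣)) ℤ.+ a
Γ-abs a x₁ x₂ x₃ γ = begin
  + (U + W)                     ≡⟨ ℤ.pos-+ U W ⟩
  + U ℤ.+ + W                   ≡⟨ rearrange (+ U) (+ V) (+ W) ⟩
  + 2 ℤ.* + V ℤ.+ (+ U - + 2 ℤ.* + V ℤ.+ + W)
    ≡⟨ cong₂ ℤ._+_ (sym (ℤ.pos-* 2 V)) (subst (λ e → e ≡ a) squares γ) ⟩
  + (2 * V) ℤ.+ a               ∎
  where
  open ≡-Reasoning
  U V W : ℕ
  U = ∣ x₁ ∣ * ∣ x₁ ∣
  V = ∣ x₂ ∣ * ∣ x₂ ∣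
  W = ∣ x₃ ∣ * ∣ x₃ ∣
  squares : x₁ ℤ.* x₁ - + 2 ℤ.* (x₂ ℤ.* x₂) ℤ.+ x₃ ℤ.* x₃ ≡ + U - + 2 ℤ.* + V ℤ.+ + W
  squares rewrite square-abs x₁ | square-abs x₂ | square-abs x₃ = refl
  rearrange : ∀ U V W → U ℤ.+ W ≡ + 2 ℤ.* V ℤ.+ (U - + 2 ℤ.* V ℤ.+ W)
  rearrange = solve-∀

Γ-nonneg : ∀ n x₁ x₂ x₃ → Γ (+ n) (x₁ , x₂ , x₃) →
           ∣ x₁ ∣ * ∣ x₁ ∣ + ∣ x₃ ∣ * ∣ x₃ ∣ + 0 ≡ 2 * (∣ x₂ ∣ * ∣ x₂ ∣) + n
Γ-nonneg n x₁ x₂ x₃ γ =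
  trans (+-identityʳ _) (ℤ.+-injective (trans (Γ-abs (+ n) x₁ x₂ x₃ γ) (sym (ℤ.pos-+ _ n))))

Γ-neg : ∀ k x₁ x₂ x₃ → Γ -[1+ k ] (x₁ , x₂ , x₃) →
        ∣ x₁ ∣ * ∣ x₁ ∣ + ∣ x₃ ∣ * ∣ x₃ ∣ + suc k ≡ 2 * (∣ x₂ ∣ * ∣ x₂ ∣) + 0
Γ-neg k x₁ x₂ x₃ γ = ℤ.+-injective (begin
  + (S + suc k)                    ≡⟨ ℤ.pos-+ S (suc k) ⟩
  + S ℤ.+ + suc k                  ≡⟨ cong (ℤ._+ + suc k) (Γ-abs -[1+ k ] x₁ x₂ x₃ γ) ⟩
  + D ℤ.+ -[1+ k ] ℤ.+ + suc k     ≡⟨ cancel (+ D) (+ suc k) ⟩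
  + D                              ≡⟨ cong +_ (sym (+-identityʳ D)) ⟩
  + (D + 0)                        ∎)
  where
  open ≡-Reasoning
  S D : ℕ
  S = ∣ x₁ ∣ * ∣ x₁ ∣ + ∣ x₃ ∣ * ∣ x₃ ∣
  D = 2 * (∣ x₂ ∣ * ∣ x₂ ∣)
  cancel : ∀ d s → d ℤ.+ ℤ.- s ℤ.+ s ≡ d
  cancel = solve-∀

swap-outer : ∀ u v w m n → u * u + w * w + m ≡ 2 * (v * v) + n →
             w * w + u * u + m ≡ 2 * (v * v) + n
swap-outer u v w m n = trans (cong (_+ m) (+-comm (w * w) (u * u)))

decreasing : ∀ x₁ x₂ x₃ →
             ∣ x₃ ∣ * ∣ x₃ ∣ < ∣ x₂ ∣ * ∣ x₂ ∣ × ∣ x₂ ∣ * ∣ x₂ ∣ < ∣ x₁ ∣ * ∣ x₁ ∣ →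
             SqDecr (x₁ , x₂ , x₃)
decreasing x₁ x₂ x₃ (w<v , v<u) = square-< x₂ x₁ v<u , square-< x₃ x₂ w<v

increasing : ∀ x₁ x₂ x₃ →
             ∣ x₁ ∣ * ∣ x₁ ∣ < ∣ x₂ ∣ * ∣ x₂ ∣ × ∣ x₂ ∣ * ∣ x₂ ∣ < ∣ x₃ ∣ * ∣ x₃ ∣ →
             SqIncr (x₁ , x₂ , x₃)
increasing x₁ x₂ x₃ (u<v , v<w) = square-< x₁ x₂ u<v , square-< x₂ x₃ v<w

nonneg-case : ∀ n x₁ x₂ x₃ → n ≤ 2 → Γ (+ n) (x₁ , x₂ , x₃) → ¬ Θ (+ n) (x₁ , x₂ , x₃) →
              SqIncr (x₁ , x₂ , x₃) ⊎ SqDecr (x₁ , x₂ , x₃)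
nonneg-case n x₁ x₂ x₃ n≤2 γ x∉Θ = by-cones (inCone? u v) (inCone? w v)
  where
  u v w : ℕ
  u = ∣ x₁ ∣ ; v = ∣ x₂ ∣ ; w = ∣ x₃ ∣
  eq : u * u + w * w + 0 ≡ 2 * (v * v) + n
  eq = Γ-nonneg n x₁ x₂ x₃ γ
  by-cones : Dec (InCone u v) → Dec (InCone w v) → SqIncr (x₁ , x₂ , x₃) ⊎ SqDecr (x₁ , x₂ , x₃)
  by-cones (yes u∈𝒞) (yes w∈𝒞) = contradiction (γ , u∈𝒞 , w∈𝒞) x∉Θ
  by-cones (no u∉𝒞) _ =
    inj₂ (decreasing x₁ x₂ x₃ (outside-cone-dominates u v w n n≤2 eq u∉𝒞))
  by-cones (yes _) (no w∉𝒞) =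
    inj₁ (increasing x₁ x₂ x₃ (outside-cone-dominates w v u n n≤2 (swap-outer u v w 0 n eq) w∉𝒞))

negative-case : ∀ k x₁ x₂ x₃ → Γ -[1+ k ] (x₁ , x₂ , x₃) → ¬ Θ -[1+ k ] (x₁ , x₂ , x₃) →
                SqIncr (x₁ , x₂ , x₃) ⊎ SqDecr (x₁ , x₂ , x₃)
negative-case k x₁ x₂ x₃ γ x∉Θ = by-size (v ℕ.<? u) (v ℕ.<? w)
  where
  u v w : ℕ
  u = ∣ x₁ ∣ ; v = ∣ x₂ ∣ ; w = ∣ x₃ ∣
  eq : u * u + w * w + suc k ≡ 2 * (v * v) + 0
  eq = Γ-neg k x₁ x₂ x₃ γ
  by-size : Dec (v < u) → Dec (v < w) → SqIncr (x₁ , x₂ , x₃) ⊎ SqDecr (x₁ , x₂ , x₃)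
  by-size (yes v<u) _ =
    inj₂ (decreasing x₁ x₂ x₃ (outer-dominates u v w (suc k) 0 eq v<u z≤n))
  by-size (no _) (yes v<w) =
    inj₁ (increasing x₁ x₂ x₃ (outer-dominates w v u (suc k) 0 (swap-outer u v w (suc k) 0 eq) v<w z≤n))
  by-size (no v≮u) (no v≮w) = contradiction (γ , ≮⇒≥ v≮u , ≮⇒≥ v≮w) x∉Θ

lemma5p1 : (a : ℤ) → ∣ a ∣ ≤ 2 → (x : ℤ³) → Γ a x → ¬ Θ a x →
    SqIncr x ⊎ SqDecr x
lemma5p1 (+ n) n≤2 (x₁ , x₂ , x₃) = nonneg-case n x₁ x₂ x₃ n≤2
lemma5p1 -[1+ k ] _ (x₁ , x₂ , x₃) = negative-case k x₁ x₂ x₃
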